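{- Let $n\ge1$ and $k\ge0$ be integers, and let $q_k=\lceil(1-\tfrac{1}{2n})\,2^k\rceil$. Then \[ H(2^k)-H(2^k-q_k)\le \ln(4\mathrm{e}\cdot n). \]
   Context: $H(m)=\sum_{j=1}^m 1/j$ is the $m$-th harmonic number, with $H(0)=0$. Note that $0\le q_k\le 2^k$. $\mathrm{e}$ is Euler's number. -}

module Defs where

open import Data.Nat using (ℕ; zero; suc; _*_; _^_; _∸_; NonZero)
open import Data.Integer using (ℤ; +_; ∣_∣)
open import Data.Rational using (ℚ; _/_; _+_; _-_; _≤_; _<_; 0ℚ; 1ℚ; ½; ceiling)
  renaming (_*_ to _*ℚ_)
open import Data.Product using (∃)

H : ℕ → ℚ
H zero    = 0ℚ
H (suc m) = H m + (+ 1 / suc m)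

-- q_k = ⌈ (1 - 1/(2n)) · 2^k ⌉  (a nonnegative integer, 0 ≤ q_k ≤ 2^k)
q : (n : ℕ) .{{_ : NonZero n}} → ℕ → ℕ
q n k = ∣ ⌈ (1ℚ - ½ *ℚ (+ 1 / n)) *ℚ (+ (2 ^ k) / 1) ⌉ ∣

expTerm : ℚ → ℕ → ℚ
expTerm x zero    = 1ℚ
expTerm x (suc j) = expTerm x j *ℚ x *ℚ (+ 1 / suc j)

expPartial : ℚ → ℕ → ℚ
expPartial x zero    = 1ℚ
expPartial x (suc N) = expPartial x N + expTerm x (suc N)

-- For a rational x ≥ 0 and a rational c:  "exp x ≤ c · e", i.e. "x ≤ ln(c · e)".
-- Since exp x = sup_N expPartial x N (nondecreasing, as x ≥ 0) and
-- e = sup_M expPartial 1 M, this holds iff every partial sum of exp x is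
-- ≤ c·e, i.e. approximable from above by c·(partial sums of e) up to any ε > 0.
_≤ln[e·_] : ℚ → ℚ → Set
x ≤ln[e· c ] = (N : ℕ) (ε : ℚ) → 0ℚ < ε →
  ∃ λ M → expPartial x N ≤ c *ℚ expPartial 1ℚ M + ε

-- Write P = 2 ^ k and m = P ∸ q n k; the ceiling gives P < 2n(m + 1).  Since
-- 1/(t+1) ≤ ln((t+1)/t), the harmonic sum telescopes to exp (H P − H m) ≤ P/m for
-- m ≥ 1, and exp (H P) = e · exp (H P − H 1) ≤ e · P; as m + 1 ≤ 2m for m ≥ 1,
-- both cases give exp (H P − H m) ≤ 2 · 2n · e.
-- All of this is carried out on the partial sums E x N = expPartial x N, with the
-- same N on both sides.  Termwise, y^(j+1) − x^(j+1) ≤ (j+1)(y − x) y^j gives the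
-- mean-value bound E (x + h) N ≤ E x N + h · E (x + h) N, which for h = 1/(t+1)
-- is the truncated form t · E (x + h) N ≤ (t+1) · E x N of exp h ≤ (t+1)/t.

module Submission where

open import Defs
open import Data.Nat using (ℕ; _*_; _^_; _∸_; NonZero)
open import Data.Integer using (+_)
open import Data.Rational using (_-_; _/_)

open import Data.Integer as ℤ using (ℤ; 1ℤ)
import Data.Integer.DivMod as ℤ
import Data.Integer.Properties as ℤ
open import Data.Nat as ℕ using (zero; suc)
import Data.Nat.Properties as ℕ
open import Data.Product using (_,_)
open import Data.Rational as ℚ using (ℚ; mkℚ; toℚᵘ; _+_; _≤_; _<_; 0ℚ; 1ℚ; ½; floor; ceiling)
  renaming (_*_ to _*ℚ_)
import Data.Rational.Properties as ℚ
open import Data.Rational.Solver using (module +-*-Solver)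
open import Data.Rational.Unnormalised as ℚᵘ using (mkℚᵘ; *≡*; *≤*; *<*)
import Data.Rational.Unnormalised.Properties as ℚᵘ
open import Algebra.Properties.Group ℚ.+-0-group using () renaming (⁻¹-involutive to neg-involutive)
open import Relation.Binary.PropositionalEquality

fromℤ : ℤ → ℚ
fromℤ i = i / 1

fromℕ : ℕ → ℚ
fromℕ n = fromℤ (+ n)

toℚᵘ-fromℤ : ∀ i → toℚᵘ (fromℤ i) ℚᵘ.≃ mkℚᵘ i 0
toℚᵘ-fromℤ i = ℚ.toℚᵘ-fromℚᵘ (mkℚᵘ i 0)

fromℤ-homo-+ : ∀ i j → fromℤ (i ℤ.+ j) ≡ fromℤ i + fromℤ j
fromℤ-homo-+ i j = ℚ.toℚᵘ-injective (begin-equality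
  toℚᵘ (fromℤ (i ℤ.+ j))              ≃⟨ toℚᵘ-fromℤ (i ℤ.+ j) ⟩
  mkℚᵘ (i ℤ.+ j) 0                    ≃⟨ *≡* (cong (ℤ._* + 1) i+j≡i*1+j*1) ⟩
  mkℚᵘ i 0 ℚᵘ.+ mkℚᵘ j 0              ≃⟨ ℚᵘ.+-cong (toℚᵘ-fromℤ i) (toℚᵘ-fromℤ j) ⟨
  toℚᵘ (fromℤ i) ℚᵘ.+ toℚᵘ (fromℤ j)  ≃⟨ ℚ.toℚᵘ-homo-+ (fromℤ i) (fromℤ j) ⟨
  toℚᵘ (fromℤ i + fromℤ j)            ∎)
  where
  open ℚᵘ.≤-Reasoning
  i+j≡i*1+j*1 : i ℤ.+ j ≡ i ℤ.* + 1 ℤ.+ j ℤ.* + 1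
  i+j≡i*1+j*1 = sym (cong₂ ℤ._+_ (ℤ.*-identityʳ i) (ℤ.*-identityʳ j))

fromℤ-homo-* : ∀ i j → fromℤ (i ℤ.* j) ≡ fromℤ i *ℚ fromℤ j
fromℤ-homo-* i j = ℚ.toℚᵘ-injective (begin-equality
  toℚᵘ (fromℤ (i ℤ.* j))               ≃⟨ toℚᵘ-fromℤ (i ℤ.* j) ⟩
  mkℚᵘ (i ℤ.* j) 0                     ≃⟨ ℚᵘ.*-cong (toℚᵘ-fromℤ i) (toℚᵘ-fromℤ j) ⟨
  toℚᵘ (fromℤ i) ℚᵘ.* toℚᵘ (fromℤ j)  ≃⟨ ℚ.toℚᵘ-homo-* (fromℤ i) (fromℤ j) ⟨
  toℚᵘ (fromℤ i *ℚ fromℤ j)            ∎)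
  where open ℚᵘ.≤-Reasoning

fromℤ-homo‿- : ∀ i → fromℤ (ℤ.- i) ≡ ℚ.- fromℤ i
fromℤ-homo‿- i = ℚ.toℚᵘ-injective (begin-equality
  toℚᵘ (fromℤ (ℤ.- i))    ≃⟨ toℚᵘ-fromℤ (ℤ.- i) ⟩
  mkℚᵘ (ℤ.- i) 0          ≃⟨ ℚᵘ.-‿cong (toℚᵘ-fromℤ i) ⟨
  ℚᵘ.- toℚᵘ (fromℤ i)     ≃⟨ ℚ.toℚᵘ-homo‿- (fromℤ i) ⟨
  toℚᵘ (ℚ.- fromℤ i)      ∎)
  where open ℚᵘ.≤-Reasoning

fromℤ-mono-≤ : ∀ {i j} → i ℤ.≤ j → fromℤ i ≤ fromℤ j
fromℤ-mono-≤ {i} {j} i≤j = ℚ.toℚᵘ-cancel-≤ (begin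
  toℚᵘ (fromℤ i)  ≃⟨ toℚᵘ-fromℤ i ⟩
  mkℚᵘ i 0        ≤⟨ *≤* (ℤ.*-monoʳ-≤-nonNeg (+ 1) i≤j) ⟩
  mkℚᵘ j 0        ≃⟨ toℚᵘ-fromℤ j ⟨
  toℚᵘ (fromℤ j)  ∎)
  where open ℚᵘ.≤-Reasoning

fromℤ-cancel-≤ : ∀ {i j} → fromℤ i ≤ fromℤ j → i ℤ.≤ j
fromℤ-cancel-≤ {i} {j} le
  with ℚᵘ.≤-respˡ-≃ (toℚᵘ-fromℤ i) (ℚᵘ.≤-respʳ-≃ (toℚᵘ-fromℤ j) (ℚ.toℚᵘ-mono-≤ le))
... | *≤* i*1≤j*1 = ℤ.*-cancelʳ-≤-pos i j (+ 1) i*1≤j*1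

fromℤ-cancel-< : ∀ {i j} → fromℤ i < fromℤ j → i ℤ.< j
fromℤ-cancel-< {i} {j} lt
  with ℚᵘ.<-respˡ-≃ (toℚᵘ-fromℤ i) (ℚᵘ.<-respʳ-≃ (toℚᵘ-fromℤ j) (ℚ.toℚᵘ-mono-< lt))
... | *<* i*1<j*1 = ℤ.*-cancelʳ-<-nonNeg (+ 1) i*1<j*1

fromℕ-homo-+ : ∀ m n → fromℕ (m ℕ.+ n) ≡ fromℕ m + fromℕ n
fromℕ-homo-+ m n = trans (cong fromℤ (ℤ.pos-+ m n)) (fromℤ-homo-+ (+ m) (+ n))

fromℕ-homo-* : ∀ m n → fromℕ (m * n) ≡ fromℕ m *ℚ fromℕ n
fromℕ-homo-* m n = trans (cong fromℤ (ℤ.pos-* m n)) (fromℤ-homo-* (+ m) (+ n))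

fromℕ-mono-≤ : ∀ {m n} → m ℕ.≤ n → fromℕ m ≤ fromℕ n
fromℕ-mono-≤ m≤n = fromℤ-mono-≤ (ℤ.+≤+ m≤n)

fromℕ-cancel-< : ∀ {m n} → fromℕ m < fromℕ n → m ℕ.< n
fromℕ-cancel-< lt = ℤ.drop‿+<+ (fromℤ-cancel-< lt)

fromℕ-pos : ∀ n .{{_ : NonZero n}} → ℚ.Positive (fromℕ n)
fromℕ-pos n = ℚ.normalize-pos n 1

fromℕ-nonNeg : ∀ n → 0ℚ ≤ fromℕ n
fromℕ-nonNeg n = fromℕ-mono-≤ {0} {n} ℕ.z≤n

1/n*n≡1 : ∀ n .{{_ : NonZero n}} → (+ 1 / n) *ℚ fromℕ n ≡ 1ℚ
1/n*n≡1 n@(suc n-1) = ℚ.toℚᵘ-injective (begin-equality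
  toℚᵘ (+ 1 / n *ℚ fromℕ n)            ≃⟨ ℚ.toℚᵘ-homo-* (+ 1 / n) (fromℕ n) ⟩
  toℚᵘ (+ 1 / n) ℚᵘ.* toℚᵘ (fromℕ n)  ≃⟨ ℚᵘ.*-cong (ℚ.toℚᵘ-fromℚᵘ (mkℚᵘ (+ 1) n-1)) (toℚᵘ-fromℤ (+ n)) ⟩
  mkℚᵘ (+ 1) n-1 ℚᵘ.* mkℚᵘ (+ n) 0    ≃⟨ ℚᵘ.*-inverseˡ (mkℚᵘ (+ n) 0) ⟩
  ℚᵘ.1ℚᵘ                               ∎)
  where open ℚᵘ.≤-Reasoning

1/n-nonNeg : ∀ n .{{_ : NonZero n}} → 0ℚ ≤ + 1 / n
1/n-nonNeg n = ℚ.nonNegative⁻¹ (+ 1 / n) {{ℚ.normalize-nonNeg 1 n}}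

p≤p+q : ∀ {p q} → 0ℚ ≤ q → p ≤ p + q
p≤p+q {p} {q} q≥0 = subst (_≤ p + q) (ℚ.+-identityʳ p) (ℚ.+-monoʳ-≤ p q≥0)

+-cancelʳ-≤ : ∀ {p q} r → p + r ≤ q + r → p ≤ q
+-cancelʳ-≤ {p} {q} r p+r≤q+r = subst₂ _≤_ (p+r-r≡p p) (p+r-r≡p q) (ℚ.+-monoˡ-≤ (ℚ.- r) p+r≤q+r)
  where
  open +-*-Solver
  p+r-r≡p : ∀ p → p + r - r ≡ p
  p+r-r≡p p = solve 2 (λ p r → p :+ r :- r := p) refl p r

*-nonNeg : ∀ {p q} → 0ℚ ≤ p → 0ℚ ≤ q → 0ℚ ≤ p *ℚ q
*-nonNeg {p} {q} p≥0 q≥0 =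
  subst (_≤ p *ℚ q) (ℚ.*-zeroˡ q) (ℚ.*-monoʳ-≤-nonNeg q {{ℚ.nonNegative q≥0}} p≥0)

*-mono-≤-nonNeg : ∀ {p q r s} → 0ℚ ≤ p → p ≤ q → 0ℚ ≤ r → r ≤ s → p *ℚ r ≤ q *ℚ s
*-mono-≤-nonNeg {p} {q} {r} {s} p≥0 p≤q r≥0 r≤s = ℚ.≤-trans
  (ℚ.*-monoʳ-≤-nonNeg r {{ℚ.nonNegative r≥0}} p≤q)
  (ℚ.*-monoˡ-≤-nonNeg q {{ℚ.nonNegative (ℚ.≤-trans p≥0 p≤q)}} r≤s)

floor-≤ : ∀ p → fromℤ (floor p) ≤ p
floor-≤ p@(mkℚ n d-1 _) = ℚ.toℚᵘ-cancel-≤ (begin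
  toℚᵘ (fromℤ (floor p))  ≃⟨ toℚᵘ-fromℤ (floor p) ⟩
  mkℚᵘ (floor p) 0        ≤⟨ *≤* ⌊p⌋*d≤n*1 ⟩
  toℚᵘ p                  ∎)
  where
  open ℚᵘ.≤-Reasoning
  ⌊p⌋*d≤n*1 : floor p ℤ.* + suc d-1 ℤ.≤ n ℤ.* + 1
  ⌊p⌋*d≤n*1 = subst (floor p ℤ.* + suc d-1 ℤ.≤_) (sym (ℤ.*-identityʳ n)) (ℤ.[n/d]*d≤n n (+ suc d-1))

<-floor+1 : ∀ p → p < fromℤ (ℤ.suc (floor p))
<-floor+1 p@(mkℚ n d-1 _) = ℚ.toℚᵘ-cancel-< (begin-strict
  toℚᵘ p                          <⟨ *<* n*1<[1+⌊p⌋]*d ⟩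
  mkℚᵘ (ℤ.suc (floor p)) 0        ≃⟨ toℚᵘ-fromℤ (ℤ.suc (floor p)) ⟨
  toℚᵘ (fromℤ (ℤ.suc (floor p)))  ∎)
  where
  open ℚᵘ.≤-Reasoning
  n*1<[1+⌊p⌋]*d : n ℤ.* + 1 ℤ.< ℤ.suc (floor p) ℤ.* + suc d-1
  n*1<[1+⌊p⌋]*d = subst₂ ℤ._<_ (sym (ℤ.*-identityʳ n))
    (cong (λ f → ℤ.suc f ℤ.* + suc d-1) (sym (ℤ.div-pos-is-/ℕ n (suc d-1))))
    (ℤ.n<s[n/ℕd]*d n (suc d-1))

≤-ceiling : ∀ p → p ≤ fromℤ (ceiling p)
≤-ceiling p@record{} = begin
  p                          ≡⟨ neg-involutive p ⟨
  ℚ.- ℚ.- p                  ≤⟨ ℚ.neg-antimono-≤ (floor-≤ (ℚ.- p)) ⟩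
  ℚ.- fromℤ (floor (ℚ.- p))  ≡⟨ fromℤ-homo‿- (floor (ℚ.- p)) ⟨
  fromℤ (ceiling p)          ∎
  where open ℚ.≤-Reasoning

ceiling-< : ∀ p → fromℤ (ceiling p) < p + 1ℚ
ceiling-< p@record{} = begin-strict
  fromℤ (ceiling p)         ≡⟨ fromℤ-homo‿- f ⟩
  ℚ.- fromℤ f               ≡⟨ solve 1 (λ x → :- x := :- (con 1ℚ :+ x) :+ con 1ℚ) refl (fromℤ f) ⟩
  ℚ.- (1ℚ + fromℤ f) + 1ℚ   ≡⟨ cong (λ x → ℚ.- x + 1ℚ) (fromℤ-homo-+ 1ℤ f) ⟨
  ℚ.- fromℤ (ℤ.suc f) + 1ℚ  <⟨ ℚ.+-monoˡ-< 1ℚ (ℚ.neg-antimono-< (<-floor+1 (ℚ.- p))) ⟩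
  ℚ.- ℚ.- p + 1ℚ            ≡⟨ cong (_+ 1ℚ) (neg-involutive p) ⟩
  p + 1ℚ                    ∎
  where
  open ℚ.≤-Reasoning
  open +-*-Solver
  f = floor (ℚ.- p)

expTerm-nonNeg : ∀ {x} → 0ℚ ≤ x → ∀ j → 0ℚ ≤ expTerm x j
expTerm-nonNeg x≥0 zero    = fromℕ-nonNeg 1
expTerm-nonNeg x≥0 (suc j) = *-nonNeg (*-nonNeg (expTerm-nonNeg x≥0 j) x≥0) (1/n-nonNeg (suc j))

expTerm-monoˡ-≤ : ∀ {x y} → 0ℚ ≤ x → x ≤ y → ∀ j → expTerm x j ≤ expTerm y j
expTerm-monoˡ-≤ x≥0 x≤y zero    = ℚ.≤-refl
expTerm-monoˡ-≤ x≥0 x≤y (suc j) = ℚ.*-monoʳ-≤-nonNeg (+ 1 / suc j) {{ℚ.normalize-nonNeg 1 (suc j)}}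
  (*-mono-≤-nonNeg (expTerm-nonNeg x≥0 j) (expTerm-monoˡ-≤ x≥0 x≤y j) x≥0 x≤y)

expTerm-suc-*-suc : ∀ x j → expTerm x (suc j) *ℚ fromℕ (suc j) ≡ expTerm x j *ℚ x
expTerm-suc-*-suc x j = begin
  expTerm x j *ℚ x *ℚ (+ 1 / suc j) *ℚ fromℕ (suc j)    ≡⟨ ℚ.*-assoc (expTerm x j *ℚ x) _ _ ⟩
  expTerm x j *ℚ x *ℚ ((+ 1 / suc j) *ℚ fromℕ (suc j))  ≡⟨ cong (expTerm x j *ℚ x *ℚ_) (1/n*n≡1 (suc j)) ⟩
  expTerm x j *ℚ x *ℚ 1ℚ                                 ≡⟨ ℚ.*-identityʳ _ ⟩
  expTerm x j *ℚ x                                       ∎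
  where open ≡-Reasoning

expTerm-+-suc-≤ : ∀ {x h} → 0ℚ ≤ x → 0ℚ ≤ h → ∀ j →
                  expTerm (x + h) (suc j) ≤ expTerm x (suc j) + h *ℚ expTerm (x + h) j
expTerm-+-suc-≤ {x} {h} x≥0 h≥0 zero = ℚ.≤-reflexive
  (solve 2 (λ x h → con 1ℚ :* (x :+ h) :* con 1ℚ := con 1ℚ :* x :* con 1ℚ :+ h :* con 1ℚ) refl x h)
  where open +-*-Solver
expTerm-+-suc-≤ {x} {h} x≥0 h≥0 (suc j) = begin
  b₁ *ℚ y *ℚ u
    ≤⟨ ℚ.*-monoʳ-≤-nonNeg u {{ℚ.normalize-nonNeg 1 (suc (suc j))}}
         (ℚ.*-monoʳ-≤-nonNeg y {{ℚ.nonNegative y≥0}} (expTerm-+-suc-≤ x≥0 h≥0 j)) ⟩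
  (a₁ + h *ℚ b₀) *ℚ y *ℚ u
    ≡⟨ solve 5 (λ a₁ b₀ x h u → (a₁ :+ h :* b₀) :* (x :+ h) :* u
                 := a₁ :* x :* u :+ h :* u :* (a₁ :+ b₀ :* (x :+ h))) refl a₁ b₀ x h u ⟩
  a₂ + h *ℚ u *ℚ (a₁ + b₀ *ℚ y)
    ≤⟨ ℚ.+-monoʳ-≤ a₂ (ℚ.*-monoˡ-≤-nonNeg (h *ℚ u) {{ℚ.nonNegative hu≥0}}
         (ℚ.+-monoˡ-≤ (b₀ *ℚ y) (expTerm-monoˡ-≤ x≥0 x≤y (suc j)))) ⟩
  a₂ + h *ℚ u *ℚ (b₁ + b₀ *ℚ y)
    ≡⟨ cong (λ z → a₂ + h *ℚ u *ℚ (b₁ + z)) (expTerm-suc-*-suc y j) ⟨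
  a₂ + h *ℚ u *ℚ (b₁ + b₁ *ℚ fromℕ (suc j))
    ≡⟨ solve 5 (λ a₂ h u b₁ f → a₂ :+ h :* u :* (b₁ :+ b₁ :* f)
                 := a₂ :+ h :* (b₁ :* (u :* (con 1ℚ :+ f)))) refl a₂ h u b₁ (fromℕ (suc j)) ⟩
  a₂ + h *ℚ (b₁ *ℚ (u *ℚ (1ℚ + fromℕ (suc j))))
    ≡⟨ cong (λ z → a₂ + h *ℚ (b₁ *ℚ (u *ℚ z))) (fromℕ-homo-+ 1 (suc j)) ⟨
  a₂ + h *ℚ (b₁ *ℚ (u *ℚ fromℕ (suc (suc j))))
    ≡⟨ cong (λ z → a₂ + h *ℚ (b₁ *ℚ z)) (1/n*n≡1 (suc (suc j))) ⟩
  a₂ + h *ℚ (b₁ *ℚ 1ℚ)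
    ≡⟨ cong (λ z → a₂ + h *ℚ z) (ℚ.*-identityʳ b₁) ⟩
  a₂ + h *ℚ b₁
    ∎
  where
  open ℚ.≤-Reasoning
  open +-*-Solver
  y = x + h
  u = + 1 / suc (suc j)
  a₁ = expTerm x (suc j)
  a₂ = expTerm x (suc (suc j))
  b₀ = expTerm y j
  b₁ = expTerm y (suc j)
  x≤y : x ≤ y
  x≤y = p≤p+q h≥0
  y≥0 : 0ℚ ≤ y
  y≥0 = ℚ.≤-trans x≥0 x≤y
  hu≥0 : 0ℚ ≤ h *ℚ u
  hu≥0 = *-nonNeg h≥0 (1/n-nonNeg (suc (suc j)))

expPartial-≤-suc : ∀ {x} → 0ℚ ≤ x → ∀ N → expPartial x N ≤ expPartial x (suc N)
expPartial-≤-suc x≥0 N = p≤p+q (expTerm-nonNeg x≥0 (suc N))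

expPartial-nonNeg : ∀ {x} → 0ℚ ≤ x → ∀ N → 0ℚ ≤ expPartial x N
expPartial-nonNeg x≥0 zero    = fromℕ-nonNeg 1
expPartial-nonNeg x≥0 (suc N) = ℚ.≤-trans (expPartial-nonNeg x≥0 N) (expPartial-≤-suc x≥0 N)

expPartial-monoˡ-≤ : ∀ {x y} → 0ℚ ≤ x → x ≤ y → ∀ N → expPartial x N ≤ expPartial y N
expPartial-monoˡ-≤ x≥0 x≤y zero    = ℚ.≤-refl
expPartial-monoˡ-≤ x≥0 x≤y (suc N) = ℚ.+-mono-≤ (expPartial-monoˡ-≤ x≥0 x≤y N) (expTerm-monoˡ-≤ x≥0 x≤y (suc N))

expPartial-+-suc-≤ : ∀ {x h} → 0ℚ ≤ x → 0ℚ ≤ h → ∀ N →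
  expPartial (x + h) (suc N) ≤ expPartial x (suc N) + h *ℚ expPartial (x + h) N
expPartial-+-suc-≤ {x} {h} x≥0 h≥0 zero = begin
  1ℚ + expTerm (x + h) 1              ≤⟨ ℚ.+-monoʳ-≤ 1ℚ (expTerm-+-suc-≤ x≥0 h≥0 0) ⟩
  1ℚ + (expTerm x 1 + h *ℚ 1ℚ)        ≡⟨ ℚ.+-assoc 1ℚ (expTerm x 1) (h *ℚ 1ℚ) ⟨
  1ℚ + expTerm x 1 + h *ℚ 1ℚ          ∎
  where open ℚ.≤-Reasoning
expPartial-+-suc-≤ {x} {h} x≥0 h≥0 (suc N) = begin
  expPartial y (suc N) + expTerm y (suc (suc N))
    ≤⟨ ℚ.+-mono-≤ (expPartial-+-suc-≤ x≥0 h≥0 N) (expTerm-+-suc-≤ x≥0 h≥0 (suc N)) ⟩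
  (expPartial x (suc N) + h *ℚ expPartial y N) + (expTerm x (suc (suc N)) + h *ℚ expTerm y (suc N))
    ≡⟨ solve 5 (λ a h b s t → (a :+ h :* b) :+ (s :+ h :* t) := (a :+ s) :+ h :* (b :+ t)) refl
         (expPartial x (suc N)) h (expPartial y N) (expTerm x (suc (suc N))) (expTerm y (suc N)) ⟩
  expPartial x (suc (suc N)) + h *ℚ expPartial y (suc N) ∎
  where
  open ℚ.≤-Reasoning
  open +-*-Solver
  y = x + h

expPartial-+-≤ : ∀ {x h} → 0ℚ ≤ x → 0ℚ ≤ h → ∀ N →
  expPartial (x + h) N ≤ expPartial x N + h *ℚ expPartial (x + h) N
expPartial-+-≤ {x} {h} x≥0 h≥0 zero = ℚ.+-monoʳ-≤ 1ℚ (*-nonNeg h≥0 (fromℕ-nonNeg 1))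
expPartial-+-≤ {x} {h} x≥0 h≥0 (suc N) = ℚ.≤-trans (expPartial-+-suc-≤ x≥0 h≥0 N)
  (ℚ.+-monoʳ-≤ (expPartial x (suc N)) (ℚ.*-monoˡ-≤-nonNeg h {{ℚ.nonNegative h≥0}} (expPartial-≤-suc y≥0 N)))
  where
  y≥0 : 0ℚ ≤ x + h
  y≥0 = ℚ.+-mono-≤ x≥0 h≥0

expPartial-+-1/[1+t]-≤ : ∀ {x} → 0ℚ ≤ x → ∀ t N →
  fromℕ t *ℚ expPartial (x + + 1 / suc t) N ≤ fromℕ (suc t) *ℚ expPartial x N
expPartial-+-1/[1+t]-≤ {x} x≥0 t N = +-cancelʳ-≤ Ey (begin
  fromℕ t *ℚ Ey + Ey
    ≡⟨ solve 2 (λ a e → a :* e :+ e := (con 1ℚ :+ a) :* e) refl (fromℕ t) Ey ⟩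
  (1ℚ + fromℕ t) *ℚ Ey
    ≡⟨ cong (_*ℚ Ey) (fromℕ-homo-+ 1 t) ⟨
  s *ℚ Ey
    ≤⟨ ℚ.*-monoˡ-≤-nonNeg s {{ℚ.nonNegative (fromℕ-nonNeg (suc t))}}
         (expPartial-+-≤ x≥0 (1/n-nonNeg (suc t)) N) ⟩
  s *ℚ (Ex + h *ℚ Ey)
    ≡⟨ solve 4 (λ s e h f → s :* (e :+ h :* f) := s :* e :+ (h :* s) :* f) refl s Ex h Ey ⟩
  s *ℚ Ex + (h *ℚ s) *ℚ Ey
    ≡⟨ cong (λ z → s *ℚ Ex + z *ℚ Ey) (1/n*n≡1 (suc t)) ⟩
  s *ℚ Ex + 1ℚ *ℚ Ey
    ≡⟨ cong (λ z → s *ℚ Ex + z) (ℚ.*-identityˡ Ey) ⟩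
  s *ℚ Ex + Ey
    ∎)
  where
  open ℚ.≤-Reasoning
  open +-*-Solver
  h = + 1 / suc t
  s = fromℕ (suc t)
  Ex = expPartial x N
  Ey = expPartial (x + h) N

0≤H[d+m]-H[m] : ∀ d m → 0ℚ ≤ H (d ℕ.+ m) - H m
0≤H[d+m]-H[m] zero    m = ℚ.≤-reflexive (sym (ℚ.+-inverseʳ (H m)))
0≤H[d+m]-H[m] (suc d) m = begin
  0ℚ                                       ≤⟨ ℚ.+-mono-≤ (0≤H[d+m]-H[m] d m) (1/n-nonNeg (suc (d ℕ.+ m))) ⟩
  H (d ℕ.+ m) - H m + + 1 / suc (d ℕ.+ m)  ≡⟨ solve 3 (λ a b c → a :- b :+ c := a :+ c :- b) refl (H (d ℕ.+ m)) (H m) _ ⟩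
  H (suc d ℕ.+ m) - H m                    ∎
  where
  open ℚ.≤-Reasoning
  open +-*-Solver

expPartial-+-H[d+m]-H[m]-≤ : ∀ {x} → 0ℚ ≤ x → ∀ m d N →
  fromℕ (suc m) *ℚ expPartial (x + (H (d ℕ.+ suc m) - H (suc m))) N ≤ fromℕ (d ℕ.+ suc m) *ℚ expPartial x N
expPartial-+-H[d+m]-H[m]-≤ {x} x≥0 m zero N = ℚ.≤-reflexive (cong (λ z → fromℕ (suc m) *ℚ expPartial z N)
  (trans (cong (λ z → x + z) (ℚ.+-inverseʳ (H (suc m)))) (ℚ.+-identityʳ x)))
expPartial-+-H[d+m]-H[m]-≤ {x} x≥0 m (suc d) N = ℚ.*-cancelˡ-≤-pos (fromℕ t) {{t-pos}} (begin
  fromℕ t *ℚ (M *ℚ expPartial (x + (H (suc t) - H (suc m))) N)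
    ≡⟨ cong (λ z → fromℕ t *ℚ (M *ℚ expPartial z N)) X+1/[1+t] ⟩
  fromℕ t *ℚ (M *ℚ expPartial (X + + 1 / suc t) N)
    ≡⟨ *-swap (fromℕ t) M _ ⟩
  M *ℚ (fromℕ t *ℚ expPartial (X + + 1 / suc t) N)
    ≤⟨ ℚ.*-monoˡ-≤-nonNeg M {{ℚ.nonNegative (fromℕ-nonNeg (suc m))}}
         (expPartial-+-1/[1+t]-≤ X≥0 t N) ⟩
  M *ℚ (fromℕ (suc t) *ℚ expPartial X N)
    ≡⟨ *-swap M (fromℕ (suc t)) _ ⟩
  fromℕ (suc t) *ℚ (M *ℚ expPartial X N)
    ≤⟨ ℚ.*-monoˡ-≤-nonNeg (fromℕ (suc t)) {{ℚ.nonNegative (fromℕ-nonNeg (suc t))}}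
         (expPartial-+-H[d+m]-H[m]-≤ x≥0 m d N) ⟩
  fromℕ (suc t) *ℚ (fromℕ t *ℚ expPartial x N)
    ≡⟨ *-swap (fromℕ (suc t)) (fromℕ t) _ ⟩
  fromℕ t *ℚ (fromℕ (suc t) *ℚ expPartial x N)
    ∎)
  where
  open ℚ.≤-Reasoning
  open +-*-Solver
  t = d ℕ.+ suc m
  M = fromℕ (suc m)
  X = x + (H t - H (suc m))
  t-pos : ℚ.Positive (fromℕ t)
  t-pos = fromℕ-pos t {{ℕ.≢-nonZero (ℕ.m+1+n≢0 d)}}
  X≥0 : 0ℚ ≤ X
  X≥0 = ℚ.+-mono-≤ x≥0 (0≤H[d+m]-H[m] d (suc m))
  X+1/[1+t] : x + (H (suc t) - H (suc m)) ≡ X + + 1 / suc t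
  X+1/[1+t] = solve 4 (λ x a b h → x :+ (a :+ h :- b) := x :+ (a :- b) :+ h) refl
                x (H t) (H (suc m)) (+ 1 / suc t)
  *-swap : ∀ a b c → a *ℚ (b *ℚ c) ≡ b *ℚ (a *ℚ c)
  *-swap = solve 3 (λ a b c → a :* (b :* c) := b :* (a :* c)) refl

expPartial-+-H[P]-H[m]-≤ : ∀ {x m P} → 0ℚ ≤ x → suc m ℕ.≤ P → ∀ N →
  fromℕ (suc m) *ℚ expPartial (x + (H P - H (suc m))) N ≤ fromℕ P *ℚ expPartial x N
expPartial-+-H[P]-H[m]-≤ {x} {m} {P} x≥0 m<P N = subst
  (λ P → fromℕ (suc m) *ℚ expPartial (x + (H P - H (suc m))) N ≤ fromℕ P *ℚ expPartial x N)
  (ℕ.m∸n+n≡m m<P) (expPartial-+-H[d+m]-H[m]-≤ x≥0 m (P ∸ suc m) N)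

P<a*[1+P∸q] : ∀ a P q → a * q ℕ.+ P ℕ.< a * suc P → P ℕ.< a * suc (P ∸ q)
P<a*[1+P∸q] a P q aq+P<a[1+P] = ℕ.+-cancelˡ-< (a * q) P (a * suc (P ∸ q)) (begin-strict
  a * q ℕ.+ P                    <⟨ aq+P<a[1+P] ⟩
  a * suc P                      ≤⟨ ℕ.*-monoʳ-≤ a (ℕ.s≤s (ℕ.m≤n+m∸n P q)) ⟩
  a * suc (q ℕ.+ (P ∸ q))        ≡⟨ cong (a *_) (ℕ.+-suc q (P ∸ q)) ⟨
  a * (q ℕ.+ suc (P ∸ q))        ≡⟨ ℕ.*-distribˡ-+ a q (suc (P ∸ q)) ⟩
  a * q ℕ.+ a * suc (P ∸ q)      ∎)
  where open ℕ.≤-Reasoning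

a*[2+m]≤2a*[1+m] : ∀ a m → a * (2 ℕ.+ m) ℕ.≤ 2 * a * suc m
a*[2+m]≤2a*[1+m] a m = begin
  a * (2 ℕ.+ m)        ≤⟨ ℕ.*-monoʳ-≤ a (ℕ.+-monoʳ-≤ 2 (ℕ.m≤n*m m 2)) ⟩
  a * (2 ℕ.+ 2 * m)    ≡⟨ cong (a *_) (ℕ.*-suc 2 m) ⟨
  a * (2 * suc m)      ≡⟨ ℕ.*-assoc a 2 (suc m) ⟨
  a * 2 * suc m        ≡⟨ cong (_* suc m) (ℕ.*-comm a 2) ⟩
  2 * a * suc m        ∎
  where open ℕ.≤-Reasoning

module _ (n : ℕ) .{{_ : NonZero n}} (P : ℕ) where

  private
    instance
      2n≢0 : NonZero (2 * n)
      2n≢0 = ℕ.m*n≢0 2 n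

  qℚ : ℚ
  qℚ = (1ℚ - ½ *ℚ (+ 1 / n)) *ℚ fromℕ P

  2n*qℚ+P≡2n*P : fromℕ (2 * n) *ℚ qℚ + fromℕ P ≡ fromℕ (2 * n * P)
  2n*qℚ+P≡2n*P = begin
    fromℕ (2 * n) *ℚ qℚ + fromℕ P
      ≡⟨ cong (λ z → z *ℚ qℚ + fromℕ P) (fromℕ-homo-* 2 n) ⟩
    fromℕ 2 *ℚ fromℕ n *ℚ qℚ + fromℕ P
      ≡⟨ solve 5 (λ a b h i p → a :* b :* ((con 1ℚ :- h :* i) :* p) :+ p
                   := a :* b :* p :+ (con 1ℚ :- (h :* a) :* (i :* b)) :* p)
                 refl (fromℕ 2) (fromℕ n) ½ (+ 1 / n) (fromℕ P) ⟩
    fromℕ 2 *ℚ fromℕ n *ℚ fromℕ P + (1ℚ - 1ℚ *ℚ ((+ 1 / n) *ℚ fromℕ n)) *ℚ fromℕ P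
      ≡⟨ cong (λ z → fromℕ 2 *ℚ fromℕ n *ℚ fromℕ P + (1ℚ - 1ℚ *ℚ z) *ℚ fromℕ P) (1/n*n≡1 n) ⟩
    fromℕ 2 *ℚ fromℕ n *ℚ fromℕ P + (1ℚ - 1ℚ *ℚ 1ℚ) *ℚ fromℕ P
      ≡⟨ solve 2 (λ a p → a :* p :+ (con 1ℚ :- con 1ℚ :* con 1ℚ) :* p := a :* p)
                 refl (fromℕ 2 *ℚ fromℕ n) (fromℕ P) ⟩
    fromℕ 2 *ℚ fromℕ n *ℚ fromℕ P
      ≡⟨ cong (_*ℚ fromℕ P) (fromℕ-homo-* 2 n) ⟨
    fromℕ (2 * n) *ℚ fromℕ P
      ≡⟨ fromℕ-homo-* (2 * n) P ⟨
    fromℕ (2 * n * P)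
      ∎
    where
    open ≡-Reasoning
    open +-*-Solver

  qℚ-nonNeg : 0ℚ ≤ qℚ
  qℚ-nonNeg = ℚ.*-cancelˡ-≤-pos (fromℕ (2 * n)) {{fromℕ-pos (2 * n)}} (+-cancelʳ-≤ (fromℕ P) (begin
    fromℕ (2 * n) *ℚ 0ℚ + fromℕ P  ≡⟨ cong (_+ fromℕ P) (ℚ.*-zeroʳ (fromℕ (2 * n))) ⟩
    0ℚ + fromℕ P                   ≡⟨ ℚ.+-identityˡ (fromℕ P) ⟩
    fromℕ P                        ≤⟨ fromℕ-mono-≤ (ℕ.m≤n*m P (2 * n)) ⟩
    fromℕ (2 * n * P)              ≡⟨ 2n*qℚ+P≡2n*P ⟨
    fromℕ (2 * n) *ℚ qℚ + fromℕ P  ∎))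
    where open ℚ.≤-Reasoning

  2n*∣⌈qℚ⌉∣+P<2n*[1+P] : 2 * n * ℤ.∣ ceiling qℚ ∣ ℕ.+ P ℕ.< 2 * n * suc P
  2n*∣⌈qℚ⌉∣+P<2n*[1+P] = fromℕ-cancel-< (begin-strict
    fromℕ (2 * n * ℤ.∣ ceiling qℚ ∣ ℕ.+ P)
      ≡⟨ fromℕ-homo-+ (2 * n * ℤ.∣ ceiling qℚ ∣) P ⟩
    fromℕ (2 * n * ℤ.∣ ceiling qℚ ∣) + fromℕ P
      ≡⟨ cong (_+ fromℕ P) (fromℕ-homo-* (2 * n) ℤ.∣ ceiling qℚ ∣) ⟩
    2n *ℚ fromℕ ℤ.∣ ceiling qℚ ∣ + fromℕ P
      ≡⟨ cong (λ c → 2n *ℚ fromℤ c + fromℕ P) (ℤ.0≤i⇒+∣i∣≡i 0≤⌈qℚ⌉) ⟩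
    2n *ℚ fromℤ (ceiling qℚ) + fromℕ P
      <⟨ ℚ.+-monoˡ-< (fromℕ P) (ℚ.*-monoʳ-<-pos 2n {{fromℕ-pos (2 * n)}} (ceiling-< qℚ)) ⟩
    2n *ℚ (qℚ + 1ℚ) + fromℕ P
      ≡⟨ solve 3 (λ a x p → a :* (x :+ con 1ℚ) :+ p := a :+ (a :* x :+ p)) refl 2n qℚ (fromℕ P) ⟩
    2n + (2n *ℚ qℚ + fromℕ P)
      ≡⟨ cong (_+_ 2n) 2n*qℚ+P≡2n*P ⟩
    2n + fromℕ (2 * n * P)
      ≡⟨ fromℕ-homo-+ (2 * n) (2 * n * P) ⟨
    fromℕ (2 * n ℕ.+ 2 * n * P)
      ≡⟨ cong fromℕ (ℕ.*-suc (2 * n) P) ⟨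
    fromℕ (2 * n * suc P)
      ∎)
    where
    open ℚ.≤-Reasoning
    open +-*-Solver
    2n = fromℕ (2 * n)
    0≤⌈qℚ⌉ : + 0 ℤ.≤ ceiling qℚ
    0≤⌈qℚ⌉ = fromℤ-cancel-≤ (ℚ.≤-trans qℚ-nonNeg (≤-ceiling qℚ))

expPartial-H[P]-H[m]-≤ : ∀ {a m P} → 1 ℕ.≤ P → m ℕ.≤ P → P ℕ.< a * suc m → ∀ N →
  expPartial (H P - H m) N ≤ fromℕ (2 * a) *ℚ expPartial 1ℚ N
expPartial-H[P]-H[m]-≤ {a} {zero} {P} 1≤P _ P<a*1 N = begin
  expPartial (H P - H 0) N                    ≡⟨ cong (λ x → expPartial x N) H[P]-H[0]≡1+H[P]-H[1] ⟩
  expPartial (1ℚ + (H P - H 1)) N             ≡⟨ ℚ.*-identityˡ _ ⟨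
  fromℕ 1 *ℚ expPartial (1ℚ + (H P - H 1)) N  ≤⟨ expPartial-+-H[P]-H[m]-≤ (fromℕ-nonNeg 1) 1≤P N ⟩
  fromℕ P *ℚ e                                ≤⟨ ℚ.*-monoʳ-≤-nonNeg e {{e-nonNeg}} (fromℕ-mono-≤ P≤2a) ⟩
  fromℕ (2 * a) *ℚ e                          ∎
  where
  open ℚ.≤-Reasoning
  open +-*-Solver
  e = expPartial 1ℚ N
  e-nonNeg : ℚ.NonNegative e
  e-nonNeg = ℚ.nonNegative (expPartial-nonNeg (fromℕ-nonNeg 1) N)
  H[P]-H[0]≡1+H[P]-H[1] : H P - H 0 ≡ 1ℚ + (H P - H 1)
  H[P]-H[0]≡1+H[P]-H[1] = solve 1 (λ h → h :- con 0ℚ := con 1ℚ :+ (h :- (con 0ℚ :+ con 1ℚ))) refl (H P)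
  P≤2a : P ℕ.≤ 2 * a
  P≤2a = ℕ.≤-trans (ℕ.<⇒≤ P<a*1) (subst (ℕ._≤ 2 * a) (sym (ℕ.*-identityʳ a)) (ℕ.m≤m+n a (a ℕ.+ 0)))
expPartial-H[P]-H[m]-≤ {a} {suc m} {P} _ m<P P<a*[2+m] N = ℚ.*-cancelˡ-≤-pos M {{fromℕ-pos (suc m)}} (begin
  M *ℚ expPartial (H P - H (suc m)) N         ≡⟨ cong (λ x → M *ℚ expPartial x N) (ℚ.+-identityˡ _) ⟨
  M *ℚ expPartial (0ℚ + (H P - H (suc m))) N  ≤⟨ expPartial-+-H[P]-H[m]-≤ ℚ.≤-refl m<P N ⟩
  fromℕ P *ℚ expPartial 0ℚ N                  ≤⟨ ℚ.*-monoˡ-≤-nonNeg (fromℕ P) {{ℚ.nonNegative (fromℕ-nonNeg P)}} e₀≤e ⟩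
  fromℕ P *ℚ e                                ≤⟨ ℚ.*-monoʳ-≤-nonNeg e {{e-nonNeg}} (fromℕ-mono-≤ P≤2a[1+m]) ⟩
  fromℕ (2 * a * suc m) *ℚ e                  ≡⟨ cong (_*ℚ e) (fromℕ-homo-* (2 * a) (suc m)) ⟩
  fromℕ (2 * a) *ℚ M *ℚ e                     ≡⟨ cong (_*ℚ e) (ℚ.*-comm (fromℕ (2 * a)) M) ⟩
  M *ℚ fromℕ (2 * a) *ℚ e                     ≡⟨ ℚ.*-assoc M (fromℕ (2 * a)) e ⟩
  M *ℚ (fromℕ (2 * a) *ℚ e)                   ∎)
  where
  open ℚ.≤-Reasoning
  M = fromℕ (suc m)
  e = expPartial 1ℚ N
  e-nonNeg : ℚ.NonNegative e
  e-nonNeg = ℚ.nonNegative (expPartial-nonNeg (fromℕ-nonNeg 1) N)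
  e₀≤e : expPartial 0ℚ N ≤ e
  e₀≤e = expPartial-monoˡ-≤ ℚ.≤-refl (fromℕ-nonNeg 1) N
  P≤2a[1+m] : P ℕ.≤ 2 * a * suc m
  P≤2a[1+m] = ℕ.<⇒≤ (ℕ.<-≤-trans P<a*[2+m] (a*[2+m]≤2a*[1+m] a m))

claim6 : (n : ℕ) .{{_ : NonZero n}} (k : ℕ) →
    (H (2 ^ k) - H (2 ^ k ∸ q n k)) ≤ln[e· (+ (4 * n) / 1) ]
claim6 n k N ε ε>0 = N , (begin
  expPartial (H P - H m) N                ≤⟨ expPartial-H[P]-H[m]-≤ {2 * n} 1≤P m≤P P<2n*[1+m] N ⟩
  fromℕ (2 * (2 * n)) *ℚ expPartial 1ℚ N  ≡⟨ cong (λ c → fromℕ c *ℚ expPartial 1ℚ N) (ℕ.*-assoc 2 2 n) ⟨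
  fromℕ (4 * n) *ℚ expPartial 1ℚ N        ≤⟨ p≤p+q (ℚ.<⇒≤ ε>0) ⟩
  fromℕ (4 * n) *ℚ expPartial 1ℚ N + ε    ∎)
  where
  open ℚ.≤-Reasoning
  P = 2 ^ k
  m = P ∸ q n k
  1≤P : 1 ℕ.≤ P
  1≤P = ℕ.m^n>0 2 k
  m≤P : m ℕ.≤ P
  m≤P = ℕ.m∸n≤m P (q n k)
  P<2n*[1+m] : P ℕ.< 2 * n * suc m
  P<2n*[1+m] = P<a*[1+P∸q] (2 * n) P (q n k) (2n*∣⌈qℚ⌉∣+P<2n*[1+P] n P)
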